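{- Let $A \neq \emptyset$ be a finite subset of $\{0,1,2,\ldots\}$ and let $m$ be its maximum element. Then $m + 1 \leq per(A^c)$, with equality if and only if $\{1,\ldots,m\} \subseteq A$.
   Context: For $B \subseteq \{0,1,2,\ldots\}$, $\partial B = \{z \in B : \{z-1,z+1\} \not\subseteq B\}$ and $per(B) = \sum_{z \in \partial B} z$. The complement is $A^c = \{0,1,2,\ldots\}\setminus A$. -}

module Defs where

open import Data.Nat using (ℕ; zero; suc; _+_; _≟_)
open import Data.Bool using (Bool; true; false; _∧_; not; if_then_else_)
open import Data.List using (List; map; upTo)
open import Data.Nat.ListAction using (sum)
open import Data.List.Membership.DecPropositional _≟_ using (_∈?_)
open import Relation.Nullary using (does)

Subset : Set
Subset = ℕ → Bool

⟦_⟧ : List ℕ → Subset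
⟦ A ⟧ z = does (z ∈? A)

compl : Subset → Subset
compl B z = not (B z)

-- z ∈ ∂B  iff  z ∈ B and {z-1, z+1} ⊄ B  (z-1 ∉ ℕ when z = 0, so 0 ∈ B ⇒ 0 ∈ ∂B).
boundary : Subset → ℕ → Bool
boundary B zero    = B zero
boundary B (suc k) = B (suc k) ∧ not (B k ∧ B (suc (suc k)))

-- Sum of the elements of ∂B lying in {0,…,N}.  When ∂B ⊆ {0,…,N}
-- this is exactly per(B).
perUpTo : Subset → ℕ → ℕ
perUpTo B N = sum (map (λ z → if boundary B z then z else 0) (upTo (suc N)))

module Submission where

-- Write C = A^c and let m = max A.  Since C contains every
-- z > m but not m, the point m+1 lies on ∂C, while every z ≥ m+2 is an
-- interior point of C.  Hence the boundary sum splits as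
--     per(C) = (boundary sum of C below m+1) + (m+1),
-- which gives m+1 ≤ per(C) at once, with equality iff no z ≤ m lies on ∂C
-- except possibly 0 (which contributes nothing).  If some k ∈ [1,m] is in C,
-- then walking right from k towards m ∉ C we meet a last element j ≥ k of a
-- run of C, and j ∈ ∂C contributes j ≥ 1.  Conversely if [1,m] ⊆ A then C
-- meets [1,m] nowhere, so nothing below m+1 other than 0 is on ∂C.

open import Defs
open import Data.Nat using (ℕ; zero; suc; _≤_; _<_; _+_; z≤n; s≤s)
open import Data.Nat.Properties
  using (≤-refl; ≤-trans; m≤n⇒m<n∨m≡n; m<n⇒m<1+n; m≤n+m; m+n≡0⇒m≡0; m+n≡0⇒n≡0;
         +-identityʳ; +-cancelʳ-≡; <⇒≱; <⇒≢; m≤n⇒m≤1+n)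
open import Data.Bool using (Bool; true; false; not; if_then_else_)
open import Data.List using (List; map; upTo; _++_; [_])
open import Data.List.Properties using (upTo-∷ʳ; map-++)
open import Data.Nat.ListAction using (sum)
open import Data.Nat.ListAction.Properties using (sum-++)
open import Data.List.Membership.Propositional using (_∈_)
open import Data.List.Membership.DecPropositional Data.Nat._≟_ using (_∈?_)
open import Data.Product using (_×_; _,_; ∃)
open import Data.Sum using (inj₁; inj₂)
open import Relation.Nullary using (¬_; yes; no; contradiction)
open import Relation.Nullary.Decidable using (dec-true; dec-false)
open import Relation.Binary.PropositionalEquality
  using (_≡_; refl; sym; trans; cong; cong₂; subst; module ≡-Reasoning)
open import Function.Bundles using (_⇔_; mk⇔; module Equivalence)

prefixSum : (ℕ → ℕ) → ℕ → ℕ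
prefixSum f n = sum (map f (upTo n))

prefixSum-suc : ∀ f n → prefixSum f (suc n) ≡ prefixSum f n + f n
prefixSum-suc f n = begin
  sum (map f (upTo (suc n)))        ≡⟨ cong (λ l → sum (map f l)) (sym (upTo-∷ʳ n)) ⟩
  sum (map f (upTo n ++ [ n ]))     ≡⟨ cong sum (map-++ f (upTo n) [ n ]) ⟩
  sum (map f (upTo n) ++ [ f n ])   ≡⟨ sum-++ (map f (upTo n)) [ f n ] ⟩
  prefixSum f n + (f n + 0)         ≡⟨ cong (prefixSum f n +_) (+-identityʳ (f n)) ⟩
  prefixSum f n + f n               ∎
  where open ≡-Reasoning

prefixSum-stable : ∀ f {a} n → a ≤ n → (∀ z → a ≤ z → f z ≡ 0)
  → prefixSum f n ≡ prefixSum f a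
prefixSum-stable f zero z≤n vanish = refl
prefixSum-stable f {a} (suc n) a≤1+n vanish with m≤n⇒m<n∨m≡n a≤1+n
... | inj₂ refl = refl
... | inj₁ (s≤s a≤n) = begin
  prefixSum f (suc n)    ≡⟨ prefixSum-suc f n ⟩
  prefixSum f n + f n    ≡⟨ cong₂ _+_ (prefixSum-stable f n a≤n vanish) (vanish n a≤n) ⟩
  prefixSum f a + 0      ≡⟨ +-identityʳ _ ⟩
  prefixSum f a          ∎
  where open ≡-Reasoning

prefixSum-zero⇒ : ∀ f n → prefixSum f n ≡ 0 → ∀ z → z < n → f z ≡ 0
prefixSum-zero⇒ f (suc n) sum≡0 z z<1+n with m≤n⇒m<n∨m≡n z<1+n
... | inj₂ refl = m+n≡0⇒n≡0 (prefixSum f n) (trans (sym (prefixSum-suc f n)) sum≡0)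
... | inj₁ (s≤s z<n) =
  prefixSum-zero⇒ f n (m+n≡0⇒m≡0 (prefixSum f n) (trans (sym (prefixSum-suc f n)) sum≡0)) z z<n

prefixSum-zero⇐ : ∀ f n → (∀ z → z < n → f z ≡ 0) → prefixSum f n ≡ 0
prefixSum-zero⇐ f zero terms≡0 = refl
prefixSum-zero⇐ f (suc n) terms≡0 = begin
  prefixSum f (suc n)  ≡⟨ prefixSum-suc f n ⟩
  prefixSum f n + f n  ≡⟨ cong₂ _+_ (prefixSum-zero⇐ f n (λ z z<n → terms≡0 z (m<n⇒m<1+n z<n)))
                                    (terms≡0 n ≤-refl) ⟩
  0                    ∎
  where open ≡-Reasoning

lastTrueBefore : (g : ℕ → Bool) {k : ℕ} (l : ℕ) → k ≤ l → g k ≡ true → g l ≡ false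
  → ∃ λ j → k ≤ j × j < l × g j ≡ true × g (suc j) ≡ false
lastTrueBefore g zero z≤n gk gl = contradiction (trans (sym gk) gl) λ ()
lastTrueBefore g (suc l) k≤1+l gk gl with m≤n⇒m<n∨m≡n k≤1+l
... | inj₂ refl = contradiction (trans (sym gk) gl) λ ()
... | inj₁ (s≤s k≤l) with g l in gl′
...   | true  = l , k≤l , ≤-refl , gl′ , gl
...   | false with lastTrueBefore g l k≤l gk gl′
...     | j , k≤j , j<l , gj , gj+1 = j , k≤j , m<n⇒m<1+n j<l , gj , gj+1

weight : Subset → ℕ → ℕ
weight B z = if boundary B z then z else 0

perUpTo-prefixSum : ∀ B N → perUpTo B N ≡ prefixSum (weight B) (suc N)
perUpTo-prefixSum B N = refl

weight-onBoundary : ∀ B z → boundary B z ≡ true → weight B z ≡ z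
weight-onBoundary B z onB rewrite onB = refl

weight-offBoundary : ∀ B z → boundary B z ≡ false → weight B z ≡ 0
weight-offBoundary B z offB rewrite offB = refl

weight-0 : ∀ B → weight B 0 ≡ 0
weight-0 B with boundary B 0
... | true  = refl
... | false = refl

boundary-outside : ∀ B z → B z ≡ false → boundary B z ≡ false
boundary-outside B zero    Bz = Bz
boundary-outside B (suc k) Bz rewrite Bz = refl

boundary-rightEnd : ∀ B j → B j ≡ true → B (suc j) ≡ false → boundary B j ≡ true
boundary-rightEnd B zero    Bj _ = Bj
boundary-rightEnd B (suc k) Bj Bj+1 rewrite Bj | Bj+1 with B k
... | true  = refl
... | false = refl

boundary-leftEnd : ∀ B k → B k ≡ false → B (suc k) ≡ true → boundary B (suc k) ≡ true
boundary-leftEnd B k Bk Bk+1 rewrite Bk | Bk+1 = refl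

boundary-interior : ∀ B k → B k ≡ true → B (suc k) ≡ true → B (suc (suc k)) ≡ true
  → boundary B (suc k) ≡ false
boundary-interior B k Bk Bk+1 Bk+2 rewrite Bk | Bk+1 | Bk+2 = refl

module FullAbove (B : Subset) (m : ℕ) (Bm : B m ≡ false)
                 (full : ∀ z → m < z → B z ≡ true) where

  boundary-m+1 : boundary B (suc m) ≡ true
  boundary-m+1 = boundary-leftEnd B m Bm (full (suc m) ≤-refl)

  weight-beyond : ∀ z → suc (suc m) ≤ z → weight B z ≡ 0
  weight-beyond (suc k) (s≤s m<k) = weight-offBoundary B (suc k)
    (boundary-interior B k (full k m<k) (full (suc k) (m≤n⇒m≤1+n m<k))
                           (full (suc (suc k)) (m≤n⇒m≤1+n (m≤n⇒m≤1+n m<k))))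

  perimeter-split : ∀ N → suc m ≤ N
    → perUpTo B N ≡ prefixSum (weight B) (suc m) + suc m
  perimeter-split N m<N = begin
    perUpTo B N
      ≡⟨ perUpTo-prefixSum B N ⟩
    prefixSum (weight B) (suc N)
      ≡⟨ prefixSum-stable (weight B) (suc N) (s≤s m<N) weight-beyond ⟩
    prefixSum (weight B) (suc (suc m))
      ≡⟨ prefixSum-suc (weight B) (suc m) ⟩
    prefixSum (weight B) (suc m) + weight B (suc m)
      ≡⟨ cong (prefixSum (weight B) (suc m) +_) (weight-onBoundary B (suc m) boundary-m+1) ⟩
    prefixSum (weight B) (suc m) + suc m
      ∎
    where open ≡-Reasoning

lowerWeights-zero⇔ : ∀ B m → B m ≡ false
  → (prefixSum (weight B) (suc m) ≡ 0) ⇔ (∀ k → 1 ≤ k → k ≤ m → B k ≡ false)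
lowerWeights-zero⇔ B m Bm = mk⇔ gapFree weightsVanish
  where
  -- A point k ∈ [1,m] of B forces a run ending at some j ∈ [k, m), and j ≥ 1
  -- then contributes to the sum.
  gapFree : prefixSum (weight B) (suc m) ≡ 0 → ∀ k → 1 ≤ k → k ≤ m → B k ≡ false
  gapFree sum≡0 k 1≤k k≤m with B k in Bk
  ... | false = refl
  ... | true with lastTrueBefore B m k≤m Bk Bm
  ...   | j , k≤j , j<m , Bj , Bj+1 = contradiction (sym j≡0) (<⇒≢ (≤-trans 1≤k k≤j))
    where
    j≡0 : j ≡ 0
    j≡0 = trans (sym (weight-onBoundary B j (boundary-rightEnd B j Bj Bj+1)))
                (prefixSum-zero⇒ (weight B) (suc m) sum≡0 j (m<n⇒m<1+n j<m))

  weightsVanish : (∀ k → 1 ≤ k → k ≤ m → B k ≡ false) → prefixSum (weight B) (suc m) ≡ 0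
  weightsVanish gap = prefixSum-zero⇐ (weight B) (suc m) vanish
    where
    vanish : ∀ z → z < suc m → weight B z ≡ 0
    vanish zero    _ = weight-0 B
    vanish (suc k) (s≤s k<m) =
      weight-offBoundary B (suc k) (boundary-outside B (suc k) (gap (suc k) (s≤s z≤n) k<m))

compl-∈ : ∀ A z → z ∈ A → compl ⟦ A ⟧ z ≡ false
compl-∈ A z z∈A = cong not (dec-true (z ∈? A) z∈A)

compl-∉ : ∀ A z → ¬ z ∈ A → compl ⟦ A ⟧ z ≡ true
compl-∉ A z z∉A = cong not (dec-false (z ∈? A) z∉A)

compl-false⇒∈ : ∀ A z → compl ⟦ A ⟧ z ≡ false → z ∈ A
compl-false⇒∈ A z Cz with z ∈? A
... | yes z∈A = z∈A
compl-false⇒∈ A z () | no _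

lemma4 : (A : List ℕ) (m : ℕ) → m ∈ A → (∀ x → x ∈ A → x ≤ m)
    → (N : ℕ) → (∀ z → boundary (compl ⟦ A ⟧) z ≡ true → z ≤ N)
    → (suc m ≤ perUpTo (compl ⟦ A ⟧) N)
      × ((suc m ≡ perUpTo (compl ⟦ A ⟧) N) ⇔ (∀ k → 1 ≤ k → k ≤ m → k ∈ A))
lemma4 A m m∈A maxA N boundedBy = lowerBound , mk⇔ equality⇒full full⇒equality
  where
  C : Subset
  C = compl ⟦ A ⟧

  Cm : C m ≡ false
  Cm = compl-∈ A m m∈A

  open FullAbove C m Cm (λ z m<z → compl-∉ A z (λ z∈A → <⇒≱ m<z (maxA z z∈A)))

  split : perUpTo C N ≡ prefixSum (weight C) (suc m) + suc m
  split = perimeter-split N (boundedBy (suc m) boundary-m+1)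

  lowerBound : suc m ≤ perUpTo C N
  lowerBound = subst (suc m ≤_) (sym split) (m≤n+m (suc m) _)

  open Equivalence (lowerWeights-zero⇔ C m Cm)
    renaming (to to gapFree; from to weightsVanish)

  equality⇒full : suc m ≡ perUpTo C N → ∀ k → 1 ≤ k → k ≤ m → k ∈ A
  equality⇒full eq k 1≤k k≤m = compl-false⇒∈ A k
    (gapFree (+-cancelʳ-≡ (suc m) _ 0 (trans (sym split) (sym eq))) k 1≤k k≤m)

  full⇒equality : (∀ k → 1 ≤ k → k ≤ m → k ∈ A) → suc m ≡ perUpTo C N
  full⇒equality full = sym (trans split (cong (_+ suc m)
    (weightsVanish (λ k 1≤k k≤m → compl-∈ A k (full k 1≤k k≤m)))))
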